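{- Let $k\ge 2$ and let $H$ be a digraph on $n$ vertices (without loops or multiple arcs, but possibly with both arcs $uv$ and $vu$) that does not contain a transitive tournament on $k$ vertices as a subgraph. For each vertex $v$ let $m(v)=\max\{d^+(v),d^-(v)\}$. Then \[\sum_{v\in V(H)}\frac{1}{n-m(v)}\le k-1.\]
   Context: $d^+(v)$ and $d^-(v)$ denote the out-degree and in-degree of $v$ in $H$. A transitive tournament on $k$ vertices in a digraph is a set of $k$ distinct vertices $x_1,\dots,x_k$ such that the arc from $x_i$ to $x_j$ is present for all $i<j$. -}

module Defs where

open import Data.Bool using (Bool; true; false; if_then_else_)
open import Data.Nat using (ℕ; zero; suc; _⊔_; _∸_)
open import Data.Fin using (Fin; _<_)
open import Data.List using (List; map; foldr)
open import Data.Nat.ListAction using (sum)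
open import Data.List using () renaming (allFin to allFinL)
open import Data.Integer using (+_)
open import Data.Rational using (ℚ; _/_; 0ℚ; _+_)
open import Data.Product using (Σ; _×_)
open import Function.Definitions using (Injective)
open import Relation.Binary.PropositionalEquality using (_≡_)
open import Relation.Nullary using (¬_)

-- A digraph on vertex set Fin n: adj u v = true iff the arc u→v is present.
-- At most one arc u→v (no multiple arcs); both u→v and v→u may be present.
Digraph : ℕ → Set
Digraph n = Fin n → Fin n → Bool

Loopless : ∀ {n} → Digraph n → Set
Loopless {n} H = (v : Fin n) → H v v ≡ false

count : ∀ {n} → (Fin n → Bool) → ℕ
count {n} P = sum (map (λ u → if P u then 1 else 0) (allFinL n))

outdeg : ∀ {n} → Digraph n → Fin n → ℕ
outdeg H v = count (λ u → H v u)

indeg : ∀ {n} → Digraph n → Fin n → ℕ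
indeg H v = count (λ u → H u v)

m : ∀ {n} → Digraph n → Fin n → ℕ
m H v = outdeg H v ⊔ indeg H v

HasTT : ∀ {n} → ℕ → Digraph n → Set
HasTT {n} k H = Σ (Fin k → Fin n) λ x →
  Injective _≡_ _≡_ x × (∀ i j → i < j → H (x i) (x j) ≡ true)

-- 1/d as a rational; the value at d = 0 is an arbitrary convention
-- (it never arises in the lemma since m(v) ≤ n-1 for loopless digraphs).
inv : ℕ → ℚ
inv zero = 0ℚ
inv (suc d) = + 1 / suc d

sumℚ : List ℚ → ℚ
sumℚ = foldr _+_ 0ℚ

sumV : ∀ {n} → (Fin n → ℚ) → ℚ
sumV {n} f = sumℚ (map f (allFinL n))

-- Generalise from V(H) to an arbitrary vertex list S, giving v ∈ S the weight
-- 1 / (|S| - m_S(v)) with degrees counted inside S, and induct on k.  Pick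
-- w ∈ S maximising m_S and let N be the larger of its out- and in-neighbourhoods
-- inside S, so |N| = m_S(w), and R = S ∖ N.  N contains no transitive
-- tournament on k - 1 vertices, since prepending (or appending) w would give one
-- on k.  Passing from S to N lowers |S| by |R| and each m(v) by at most |R|, so
-- no weight on N decreases; and each v ∈ R has |S| - m_S(v) ≥ |S| - |N| = |R|,
-- so R contributes at most 1.
module Submission where

open import Defs
open import Algebra.Bundles using (CommutativeMonoid)
open import Data.Bool using (Bool; true; false; not; if_then_else_; T; T?)
open import Data.Bool.Properties using (T-≡)
open import Data.Fin as Fin using (Fin; zero; suc; opposite)
import Data.Fin.Properties as Fin
open import Data.Integer as ℤ using (+_)
import Data.Integer.Properties as ℤ
open import Data.Integer.Solver using (module +-*-Solver)
open import Data.List using (List; []; _∷_; map; length; filterᵇ; allFin)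
open import Data.List.Extrema.Nat using (argmax; argmax-sel; f[⊥]≤f[argmax]; f[xs]≤f[argmax])
open import Data.List.Membership.Propositional using (_∈_; lose)
open import Data.List.Membership.Propositional.Properties using (∈-filter⁻; ∈-length)
import Data.List.Properties as List
open import Data.List.Relation.Unary.All as All using (_∷_)
open import Data.List.Relation.Unary.Any using (here; there)
open import Data.Nat as ℕ using (ℕ; zero; suc; z≤n; s≤s; _⊔_; _∸_; _≥_)
import Data.Nat.Properties as ℕ
open import Data.Nat.ListAction using (sum)
open import Data.Product using (Σ; _×_; _,_; proj₁; proj₂)
open import Data.Rational using (ℚ; _/_; _≤_; _+_; 0ℚ; 1ℚ; toℚᵘ; fromℚᵘ)
open import Data.Rational.Properties
open import Data.Rational.Unnormalised as ℚᵘ using (mkℚᵘ; *≡*; *≤*)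
import Data.Rational.Unnormalised.Properties as ℚᵘ
open import Data.Sum using (inj₁; inj₂)
import Data.Vec.Functional as Vector
open import Function using (id; flip; _∘_; Equivalence)
open import Function.Definitions using (Injective)
open import Relation.Binary.PropositionalEquality
open import Relation.Nullary using (¬_; contradiction)
open import Algebra.Properties.CommutativeSemigroup
  (CommutativeMonoid.commutativeSemigroup +-0-commutativeMonoid) using (x∙yz≈y∙xz)

fromℚᵘ-homo-+ : ∀ p q → fromℚᵘ (p ℚᵘ.+ q) ≡ fromℚᵘ p + fromℚᵘ q
fromℚᵘ-homo-+ p q = toℚᵘ-injective (begin
  toℚᵘ (fromℚᵘ (p ℚᵘ.+ q))              ≈⟨ toℚᵘ-fromℚᵘ (p ℚᵘ.+ q) ⟩
  p ℚᵘ.+ q                              ≈⟨ ℚᵘ.+-cong (toℚᵘ-fromℚᵘ p) (toℚᵘ-fromℚᵘ q) ⟨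
  toℚᵘ (fromℚᵘ p) ℚᵘ.+ toℚᵘ (fromℚᵘ q)  ≈⟨ toℚᵘ-homo-+ (fromℚᵘ p) (fromℚᵘ q) ⟨
  toℚᵘ (fromℚᵘ p + fromℚᵘ q)            ∎)
  where open ℚᵘ.≃-Reasoning

fromℚᵘ-mono-≤ : ∀ {p q} → p ℚᵘ.≤ q → fromℚᵘ p ≤ fromℚᵘ q
fromℚᵘ-mono-≤ {p} {q} p≤q = toℚᵘ-cancel-≤
  (ℚᵘ.≤-respˡ-≃ (ℚᵘ.≃-sym (toℚᵘ-fromℚᵘ p)) (ℚᵘ.≤-respʳ-≃ (ℚᵘ.≃-sym (toℚᵘ-fromℚᵘ q)) p≤q))

-- `i / suc d` is definitionally `fromℚᵘ (mkℚᵘ i d)`.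
+-/-sameDenominator : ∀ i j d → i / suc d + j / suc d ≡ (i ℤ.+ j) / suc d
+-/-sameDenominator i j d = begin
  i / suc d + j / suc d            ≡⟨ fromℚᵘ-homo-+ (mkℚᵘ i d) (mkℚᵘ j d) ⟨
  fromℚᵘ (mkℚᵘ i d ℚᵘ.+ mkℚᵘ j d)  ≡⟨ fromℚᵘ-cong sum≃ ⟩
  (i ℤ.+ j) / suc d                ∎
  where
  open ≡-Reasoning
  sum≃ : mkℚᵘ i d ℚᵘ.+ mkℚᵘ j d ℚᵘ.≃ mkℚᵘ (i ℤ.+ j) d
  sum≃ = *≡* (solve 3 (λ i j D → (i :* D :+ j :* D) :* D := (i :+ j) :* (D :* D)) refl i j (+ suc d))
    where open +-*-Solver

n/n≡1 : ∀ d → + suc d / suc d ≡ 1ℚ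
n/n≡1 d = fromℚᵘ-cong {mkℚᵘ (+ suc d) d} {ℚᵘ.1ℚᵘ} (*≡* (ℤ.*-comm (+ suc d) (+ 1)))

inv-antimono-≤ : ∀ {a b} → 0 ℕ.< b → b ℕ.≤ a → inv a ≤ inv b
inv-antimono-≤ {suc a} {suc b} _ b≤a =
  fromℚᵘ-mono-≤ {mkℚᵘ (+ 1) a} {mkℚᵘ (+ 1) b} (*≤* (ℤ.*-monoˡ-≤-nonNeg (+ 1) (ℤ.+≤+ b≤a)))

p≤n+o⇒m∸n≤[m+o]∸p : ∀ m n o {p} → p ℕ.≤ n ℕ.+ o → m ∸ n ℕ.≤ (m ℕ.+ o) ∸ p
p≤n+o⇒m∸n≤[m+o]∸p m n o {p} p≤n+o = begin
  m ∸ n                    ≡⟨ ℕ.[m+n]∸[m+o]≡n∸o o m n ⟨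
  (o ℕ.+ m) ∸ (o ℕ.+ n)    ≡⟨ cong₂ _∸_ (ℕ.+-comm o m) (ℕ.+-comm o n) ⟩
  (m ℕ.+ o) ∸ (n ℕ.+ o)    ≤⟨ ℕ.∸-monoʳ-≤ (m ℕ.+ o) p≤n+o ⟩
  (m ℕ.+ o) ∸ p            ∎
  where open ℕ.≤-Reasoning

p≤m⇒n≤[m+n]∸p : ∀ m n {p} → p ℕ.≤ m → n ℕ.≤ (m ℕ.+ n) ∸ p
p≤m⇒n≤[m+n]∸p m n {p} p≤m = begin
  n                  ≡⟨ ℕ.m+n∸m≡n m n ⟨
  (m ℕ.+ n) ∸ m      ≤⟨ ℕ.∸-monoʳ-≤ (m ℕ.+ n) p≤m ⟩
  (m ℕ.+ n) ∸ p      ∎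
  where open ℕ.≤-Reasoning

module _ {A : Set} where

  ∈-filterᵇ⁻ : ∀ (P : A → Bool) {x xs} → x ∈ filterᵇ P xs → x ∈ xs × P x ≡ true
  ∈-filterᵇ⁻ P x∈ with x∈xs , Px ← ∈-filter⁻ (T? ∘ P) x∈ = x∈xs , Equivalence.to T-≡ Px

  length-filterᵇ<length : ∀ (P : A → Bool) {x xs} → x ∈ xs → P x ≡ false →
    length (filterᵇ P xs) ℕ.< length xs
  length-filterᵇ<length P {xs = xs} x∈xs Px≡false =
    List.filter-notAll (T? ∘ P) xs (lose x∈xs (subst T Px≡false))

  length-filterᵇ-split : ∀ (P : A → Bool) xs →
    length xs ≡ length (filterᵇ P xs) ℕ.+ length (filterᵇ (not ∘ P) xs)
  length-filterᵇ-split P []       = refl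
  length-filterᵇ-split P (x ∷ xs) with P x
  ... | true  = cong suc (length-filterᵇ-split P xs)
  ... | false = trans (cong suc (length-filterᵇ-split P xs)) (sym (ℕ.+-suc _ _))

  length-filterᵇ-≤-split : ∀ (P Q : A → Bool) xs →
    length (filterᵇ Q xs) ℕ.≤ length (filterᵇ Q (filterᵇ P xs)) ℕ.+ length (filterᵇ (not ∘ P) xs)
  length-filterᵇ-≤-split P Q []       = z≤n
  length-filterᵇ-≤-split P Q (x ∷ xs) with P x
  ... | true with Q x
  ...   | true  = s≤s (length-filterᵇ-≤-split P Q xs)
  ...   | false = length-filterᵇ-≤-split P Q xs
  length-filterᵇ-≤-split P Q (x ∷ xs) | false with Q x
  ...   | true  = ℕ.≤-trans (s≤s (length-filterᵇ-≤-split P Q xs))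
                            (ℕ.≤-reflexive (sym (ℕ.+-suc _ _)))
  ...   | false = ℕ.≤-trans (length-filterᵇ-≤-split P Q xs) (ℕ.+-monoʳ-≤ _ (ℕ.n≤1+n _))

  count≡length-filterᵇ : ∀ (P : A → Bool) xs →
    sum (map (λ x → if P x then 1 else 0) xs) ≡ length (filterᵇ P xs)
  count≡length-filterᵇ P []       = refl
  count≡length-filterᵇ P (x ∷ xs) with P x
  ... | true  = cong suc (count≡length-filterᵇ P xs)
  ... | false = count≡length-filterᵇ P xs

  argmax∈ : ∀ (f : A → ℕ) x xs → argmax f x xs ∈ x ∷ xs
  argmax∈ f x xs with argmax-sel f x xs
  ... | inj₁ argmax≡x = here argmax≡x
  ... | inj₂ argmax∈xs = there argmax∈xs

  f[argmax]-maximal : ∀ (f : A → ℕ) x xs {v} → v ∈ x ∷ xs → f v ℕ.≤ f (argmax f x xs)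
  f[argmax]-maximal f x xs = All.lookup (f[⊥]≤f[argmax] {f = f} x xs ∷ f[xs]≤f[argmax] x xs)

  sumℚ-mono-≤ : ∀ (f g : A → ℚ) xs → (∀ {x} → x ∈ xs → f x ≤ g x) →
                sumℚ (map f xs) ≤ sumℚ (map g xs)
  sumℚ-mono-≤ f g []       f≤g = ≤-refl
  sumℚ-mono-≤ f g (x ∷ xs) f≤g = +-mono-≤ (f≤g (here refl)) (sumℚ-mono-≤ f g xs (f≤g ∘ there))

  sumℚ-≤-length/ : ∀ (f : A → ℚ) d xs → (∀ {x} → x ∈ xs → f x ≤ + 1 / suc d) →
                   sumℚ (map f xs) ≤ + length xs / suc d
  sumℚ-≤-length/ f d []       _   = ≤-reflexive (sym (0/n≡0 (suc d)))
  sumℚ-≤-length/ f d (x ∷ xs) f≤c = begin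
    f x + sumℚ (map f xs)              ≤⟨ +-mono-≤ (f≤c (here refl)) (sumℚ-≤-length/ f d xs (f≤c ∘ there)) ⟩
    + 1 / suc d + + length xs / suc d  ≡⟨ +-/-sameDenominator (+ 1) (+ length xs) d ⟩
    + suc (length xs) / suc d          ∎
    where open ≤-Reasoning

  sumℚ-≤-1 : ∀ (f : A → ℚ) xs → (∀ {x} → x ∈ xs → f x ≤ inv (length xs)) →
             sumℚ (map f xs) ≤ 1ℚ
  sumℚ-≤-1 f []          _   = nonNegative⁻¹ 1ℚ
  sumℚ-≤-1 f xs@(_ ∷ ys) f≤c =
    ≤-trans (sumℚ-≤-length/ f (length ys) xs f≤c) (≤-reflexive (n/n≡1 (length ys)))

  sumℚ-filterᵇ-split : ∀ (P : A → Bool) (f : A → ℚ) xs →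
    sumℚ (map f xs) ≡ sumℚ (map f (filterᵇ P xs)) + sumℚ (map f (filterᵇ (not ∘ P) xs))
  sumℚ-filterᵇ-split P f []       = sym (+-identityˡ 0ℚ)
  sumℚ-filterᵇ-split P f (x ∷ xs) with P x
  ... | true  = trans (cong (_+_ (f x)) (sumℚ-filterᵇ-split P f xs))
                      (sym (+-assoc (f x) (sumOver P) (sumOver (not ∘ P))))
    where sumOver : (A → Bool) → ℚ
          sumOver Q = sumℚ (map f (filterᵇ Q xs))
  ... | false = trans (cong (_+_ (f x)) (sumℚ-filterᵇ-split P f xs))
                      (x∙yz≈y∙xz (f x) (sumOver P) (sumOver (not ∘ P)))
    where sumOver : (A → Bool) → ℚ
          sumOver Q = sumℚ (map f (filterᵇ Q xs))

opposite-injective : ∀ {k} → Injective _≡_ _≡_ (opposite {k})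
opposite-injective {_} {i} {j} eq = begin
  i                      ≡⟨ Fin.opposite-involutive i ⟨
  opposite (opposite i)  ≡⟨ cong opposite eq ⟩
  opposite (opposite j)  ≡⟨ Fin.opposite-involutive j ⟩
  j                      ∎
  where open ≡-Reasoning

opposite-< : ∀ {k} {i j : Fin k} → i Fin.< j → opposite j Fin.< opposite i
opposite-< {k} {i} {j} i<j = subst₂ ℕ._<_ (sym (Fin.opposite-prop j)) (sym (Fin.opposite-prop i))
  (ℕ.∸-monoʳ-< (s≤s i<j) (Fin.toℕ<n j))

IsTT : ∀ {n k} → Digraph n → (Fin k → Fin n) → Set
IsTT H x = Injective _≡_ _≡_ x × (∀ i j → i Fin.< j → H (x i) (x j) ≡ true)

HasTTIn : ∀ {n} → ℕ → Digraph n → List (Fin n) → Set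
HasTTIn {n} k H S = Σ (Fin k → Fin n) λ x → IsTT H x × (∀ i → x i ∈ S)

module _ {n} {H : Digraph n} where

  IsTT-cons : ∀ {k w} {x : Fin k → Fin n} → H w w ≡ false → (∀ i → H w (x i) ≡ true) →
              IsTT H x → IsTT H (w Vector.∷ x)
  IsTT-cons {w = w} {x} Hww≡false Hwx (x-injective , x-arcs) = injective , arcs
    where
    w≢x : ∀ i → w ≢ x i
    w≢x i refl with () ← trans (sym Hww≡false) (Hwx i)
    injective : Injective _≡_ _≡_ (w Vector.∷ x)
    injective {zero}  {zero}  _  = refl
    injective {zero}  {suc j} eq = contradiction eq (w≢x j)
    injective {suc i} {zero}  eq = contradiction (sym eq) (w≢x i)
    injective {suc i} {suc j} eq = cong suc (x-injective eq)
    arcs : ∀ i j → i Fin.< j → H ((w Vector.∷ x) i) ((w Vector.∷ x) j) ≡ true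
    arcs zero    (suc j) _         = Hwx j
    arcs (suc i) (suc j) (s≤s i<j) = x-arcs i j i<j

  IsTT-reverse : ∀ {k} {x : Fin k → Fin n} → IsTT H x → IsTT (flip H) (Vector.reverse x)
  IsTT-reverse (x-injective , x-arcs) =
    opposite-injective ∘ x-injective , λ i j i<j → x-arcs (opposite j) (opposite i) (opposite-< i<j)

  HasTTIn-reverse : ∀ {k S} → HasTTIn k H S → HasTTIn k (flip H) S
  HasTTIn-reverse (x , tt , x∈S) = Vector.reverse x , IsTT-reverse tt , x∈S ∘ opposite

  HasTTIn-singleton : ∀ {S v} → v ∈ S → HasTTIn 1 H S
  HasTTIn-singleton {v = v} v∈S = (λ _ → v) , (injective , λ { zero zero () }) , λ _ → v∈S
    where
    injective : Injective _≡_ _≡_ (λ (_ : Fin 1) → v)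
    injective {zero} {zero} _ = refl

  HasTTIn-extend-out : ∀ {k S w} → H w w ≡ false → w ∈ S →
                       HasTTIn k H (filterᵇ (H w) S) → HasTTIn (suc k) H S
  HasTTIn-extend-out {S = S} {w} Hww≡false w∈S (x , tt , x∈N) =
    w Vector.∷ x , IsTT-cons Hww≡false (proj₂ ∘ x∈N⁻) tt , members
    where
    x∈N⁻ : ∀ i → x i ∈ S × H w (x i) ≡ true
    x∈N⁻ i = ∈-filterᵇ⁻ (H w) (x∈N i)
    members : ∀ i → (w Vector.∷ x) i ∈ S
    members zero    = w∈S
    members (suc i) = proj₁ (x∈N⁻ i)

HasTTIn-extend-in : ∀ {n k S w} {H : Digraph n} → H w w ≡ false → w ∈ S →
                    HasTTIn k H (filterᵇ (flip H w) S) → HasTTIn (suc k) H S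
HasTTIn-extend-in {H = H} Hww≡false w∈S tt =
  HasTTIn-reverse {H = flip H}
    (HasTTIn-extend-out {H = flip H} Hww≡false w∈S (HasTTIn-reverse {H = H} tt))

module _ {n} (H : Digraph n) where

  outdegIn indegIn mIn : List (Fin n) → Fin n → ℕ
  outdegIn S v = length (filterᵇ (H v) S)
  indegIn  S v = length (filterᵇ (flip H v) S)
  mIn      S v = outdegIn S v ⊔ indegIn S v

  weightIn : List (Fin n) → Fin n → ℚ
  weightIn S v = inv (length S ∸ mIn S v)

  mIn-filterᵇ-≤ : ∀ P S v → mIn S v ℕ.≤ mIn (filterᵇ P S) v ℕ.+ length (filterᵇ (not ∘ P) S)
  mIn-filterᵇ-≤ P S v = begin
    outdegIn S v ⊔ indegIn S v                      ≤⟨ ℕ.⊔-mono-≤ (length-filterᵇ-≤-split P (H v) S)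
                                                                  (length-filterᵇ-≤-split P (flip H v) S) ⟩
    (outdegIn N v ℕ.+ |R|) ⊔ (indegIn N v ℕ.+ |R|)  ≡⟨ ℕ.+-distribʳ-⊔ |R| (outdegIn N v) (indegIn N v) ⟨
    mIn N v ℕ.+ |R|                                 ∎
    where
    open ℕ.≤-Reasoning
    N : List (Fin n)
    N = filterᵇ P S
    |R| : ℕ
    |R| = length (filterᵇ (not ∘ P) S)

  weightIn-allFin : ∀ v → weightIn (allFin n) v ≡ inv (n ∸ m H v)
  weightIn-allFin v = cong inv (cong₂ _∸_ (List.length-tabulate id)
    (sym (cong₂ _⊔_ (count≡length-filterᵇ (H v) (allFin n))
                    (count≡length-filterᵇ (flip H v) (allFin n)))))

  module _ (loopless : Loopless H) where

    mIn<length : ∀ {S v} → v ∈ S → mIn S v ℕ.< length S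
    mIn<length v∈S =
      ℕ.⊔-lub (length-filterᵇ<length _ v∈S (loopless _)) (length-filterᵇ<length _ v∈S (loopless _))

    sum-weightIn-filterᵇ : ∀ P S → (∀ {v} → v ∈ S → mIn S v ℕ.≤ length (filterᵇ P S)) →
      sumℚ (map (weightIn S) S) ≤ sumℚ (map (weightIn (filterᵇ P S)) (filterᵇ P S)) + 1ℚ
    sum-weightIn-filterᵇ P S m≤|N| = begin
      sumℚ (map (weightIn S) S)                              ≡⟨ sumℚ-filterᵇ-split P (weightIn S) S ⟩
      sumℚ (map (weightIn S) N) + sumℚ (map (weightIn S) R)  ≤⟨ +-mono-≤ (sumℚ-mono-≤ _ _ N weight-on-N)
                                                                         (sumℚ-≤-1 _ R weight-on-R) ⟩
      sumℚ (map (weightIn N) N) + 1ℚ                         ∎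
      where
      open ≤-Reasoning
      N R : List (Fin n)
      N = filterᵇ P S
      R = filterᵇ (not ∘ P) S
      |S|≡|N|+|R| : length S ≡ length N ℕ.+ length R
      |S|≡|N|+|R| = length-filterᵇ-split P S
      weight-on-N : ∀ {v} → v ∈ N → weightIn S v ≤ weightIn N v
      weight-on-N {v} v∈N = inv-antimono-≤ (ℕ.m<n⇒0<n∸m (mIn<length v∈N))
        (subst (λ s → length N ∸ mIn N v ℕ.≤ s ∸ mIn S v) (sym |S|≡|N|+|R|)
          (p≤n+o⇒m∸n≤[m+o]∸p (length N) (mIn N v) (length R) (mIn-filterᵇ-≤ P S v)))
      weight-on-R : ∀ {v} → v ∈ R → weightIn S v ≤ inv (length R)
      weight-on-R {v} v∈R = inv-antimono-≤ (∈-length v∈R)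
        (subst (λ s → length R ℕ.≤ s ∸ mIn S v) (sym |S|≡|N|+|R|)
          (p≤m⇒n≤[m+n]∸p (length N) (length R) (m≤|N| (proj₁ (∈-filterᵇ⁻ (not ∘ P) v∈R)))))

    larger-neighbourhood : ∀ {k S w} → w ∈ S → Σ (Fin n → Bool) λ P →
      length (filterᵇ P S) ≡ mIn S w × (HasTTIn k H (filterᵇ P S) → HasTTIn (suc k) H S)
    larger-neighbourhood {S = S} {w} w∈S with ℕ.⊔-sel (outdegIn S w) (indegIn S w)
    ... | inj₁ m≡out = H w , sym m≡out , HasTTIn-extend-out (loopless w) w∈S
    ... | inj₂ m≡in  = flip H w , sym m≡in , HasTTIn-extend-in (loopless w) w∈S

    sum-weightIn-≤ : ∀ k S → ¬ HasTTIn (suc k) H S → sumℚ (map (weightIn S) S) ≤ + k / 1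
    sum-weightIn-≤ k       []       _    = nonNegative⁻¹ (+ k / 1) {{normalize-nonNeg k 1}}
    sum-weightIn-≤ zero    (x ∷ xs) noTT = contradiction (HasTTIn-singleton {H = H} (here refl)) noTT
    sum-weightIn-≤ (suc k) S@(x ∷ xs) noTT
      with P , |N|≡mw , extend ← larger-neighbourhood {k = suc k} (argmax∈ (mIn S) x xs) = begin
        sumℚ (map (weightIn S) S)       ≤⟨ sum-weightIn-filterᵇ P S m≤|N| ⟩
        sumℚ (map (weightIn N) N) + 1ℚ  ≤⟨ +-monoˡ-≤ 1ℚ (sum-weightIn-≤ k N (noTT ∘ extend)) ⟩
        + k / 1 + 1ℚ                    ≡⟨ +-comm (+ k / 1) 1ℚ ⟩
        1ℚ + + k / 1                    ≡⟨ +-/-sameDenominator (+ 1) (+ k) 0 ⟩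
        + suc k / 1                     ∎
      where
      open ≤-Reasoning
      N : List (Fin n)
      N = filterᵇ P S
      m≤|N| : ∀ {v} → v ∈ S → mIn S v ℕ.≤ length N
      m≤|N| {v} v∈S = subst (mIn S v ℕ.≤_) (sym |N|≡mw) (f[argmax]-maximal (mIn S) x xs v∈S)

lemma2p4 : (k n : ℕ) → k ≥ 2 → (H : Digraph n) → Loopless H → ¬ HasTT k H →
    sumV (λ v → inv (n ∸ m H v)) ≤ (+ (k ∸ 1)) / 1
lemma2p4 (suc (suc k)) n (s≤s (s≤s z≤n)) H loopless noTT = begin
  sumV (λ v → inv (n ∸ m H v))                   ≡⟨ cong sumℚ (List.map-cong (weightIn-allFin H) (allFin n)) ⟨
  sumℚ (map (weightIn H (allFin n)) (allFin n))  ≤⟨ sum-weightIn-≤ H loopless (suc k) (allFin n)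
                                                      (λ (x , tt , _) → noTT (x , tt)) ⟩
  + suc k / 1                                    ∎
  where open ≤-Reasoning
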